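{- Let $n$ be a positive integer. Then $$\tau(n+1)\equiv\sum_{\substack{(l,m,s,r)\in\mathbb{Z}^4\\ n=\frac{l(3l-1)}{2}+\frac{m(3m-1)}{2}+11\frac{s(3s-1)}{2}+11\frac{r(3r-1)}{2}}}(-1)^{l+m+s+r}\pmod{11}.$$
   Context: $\tau$ is Ramanujan's tau function: $q\prod_{m=1}^{\infty}(1-q^m)^{24}=\sum_{n\geq1}\tau(n)q^n$. The numbers $\frac{j(3j-1)}{2}$, $j\in\mathbb{Z}$, are the generalized pentagonal numbers $\frac{3l^2\pm l}{2}$, $l\geq0$, the sign $(-1)^j$ agreeing with $(-1)^l$. -}

module Defs where

open import Data.Nat as ℕ using (ℕ; zero; suc)
open import Data.Integer using (ℤ; +_; -_; _+_; _*_; _-_; _/_)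
open import Data.List using (List; []; _∷_; map; foldr; upTo)
open import Data.Product using (_×_; _,_)
open import Data.Bool using (true; false)

sumℤ : List ℤ → ℤ
sumℤ = foldr _+_ (+ 0)

-- Formal power series with integer coefficients: coefficient functions ℕ → ℤ.
Series : Set
Series = ℕ → ℤ

_⊛_ : Series → Series → Series
(f ⊛ g) k = sumℤ (map (λ i → f i * g (k ℕ.∸ i)) (upTo (suc k)))

oneS : Series
oneS zero    = + 1
oneS (suc _) = + 0

-- the series 1 - q^m  (used for m ≥ 1)
oneMinusQ : ℕ → Series
oneMinusQ m k with k ℕ.≡ᵇ 0 | k ℕ.≡ᵇ m
... | true  | _     = + 1
... | false | true  = - + 1
... | false | false = + 0

powS : Series → ℕ → Series
powS f zero    = oneS
powS f (suc e) = f ⊛ powS f e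

partialEta24 : ℕ → Series
partialEta24 zero    = oneS
partialEta24 (suc N) = powS (oneMinusQ (suc N)) 24 ⊛ partialEta24 N

-- Ramanujan's tau: q ∏_{m≥1} (1-q^m)^24 = Σ_{n≥1} τ(n) q^n.
-- τ(n+1) is the q^n coefficient of ∏_{m≥1}(1-q^m)^24; factors with m > n
-- do not affect this coefficient, so the finite product up to m = n suffices.
τ : ℕ → ℤ
τ zero    = + 0
τ (suc n) = partialEta24 n n

-- generalized pentagonal number j(3j-1)/2 (exact division: j(3j-1) is even)
pent : ℤ → ℤ
pent j = (j * (+ 3 * j - + 1)) / + 2

sgn : ℤ → ℤ     -- (-1)^j
sgn (+ k)     = sgnℕ k
  where
  sgnℕ : ℕ → ℤ
  sgnℕ zero = + 1
  sgnℕ (suc zero) = - + 1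
  sgnℕ (suc (suc k)) = sgnℕ k
sgn (ℤ.negsuc k) = - sgn (+ k)
  where import Data.Integer as ℤ

Quad : Set
Quad = ℤ × ℤ × ℤ × ℤ

IsRep : ℕ → Quad → Set
IsRep n (l , m , s , r) = + n ≡ pent l + pent m + + 11 * pent s + + 11 * pent r
  where open import Relation.Binary.PropositionalEquality using (_≡_)

weight : Quad → ℤ
weight (l , m , s , r) = sgn (l + m + s + r)

open import Data.List.Relation.Unary.Unique.Propositional using (Unique)
open import Data.List.Membership.Propositional using (_∈_)
open import Function.Bundles using (_⇔_)

IsEnumeration : ℕ → List Quad → Set
IsEnumeration n L = Unique L Data.Product.× (∀ q → (q ∈ L) ⇔ IsRep n q)
  where import Data.Product

weightSum : List Quad → ℤ
weightSum L = sumℤ (map weight L)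

-- Modulo 11 the Frobenius identity
-- (1 − y)¹¹ ≡ 1 − y¹¹ turns (1 − qᵐ)²⁴ = (1 − qᵐ)² ((1 − qᵐ)¹¹)² into (1 − qᵐ)² (1 − q¹¹ᵐ)²,
-- so the product becomes (q; q)∞² (q¹¹; q¹¹)∞².  Below degree n + 1 each of these Euler
-- products agrees with its truncated pentagonal sum Σ_{|j| ≤ n} (−1)ʲ x^P(j), P(j) = j(3j − 1)/2,
-- x = q or q¹¹: this finite form of Euler's pentagonal theorem is Shanks' identity, proved by a
-- telescoping sum.  Multiplying out the four pentagonal sums, the coefficient of qⁿ is the
-- signed count of the (l, m, s, r) with n = P(l) + P(m) + 11 P(s) + 11 P(r).  In the ring of
-- integer series with coefficients read modulo 11 all of these steps are ring identities.

module Submission where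

open import Defs
open import Data.Nat as ℕ using (ℕ; zero; suc; pred; _∸_; _≤_; _<_; z≤n; s≤s; _≡ᵇ_; NonZero)
import Data.Nat.Properties as ℕₚ
open import Data.Nat.DivMod using (m*n/n≡m)
open import Data.Nat.Tactic.RingSolver using (solve-∀)
open import Data.Integer as ℤ using (ℤ; +_; -[1+_]; -_; _+_; _*_; _-_)
import Data.Integer.Properties as ℤₚ
open import Data.Integer.Divisibility using (_∣_)
open import Data.Integer.Divisibility.Signed as ℤ∣ using (divides)
open import Data.Integer.Solver using (module +-*-Solver)
open import Data.Bool using (true; false; T)
open import Data.Unit using (tt)
open import Data.Maybe using (Maybe; just; nothing)
open import Data.Product using (Σ; _×_; _,_; proj₂)
open import Data.Sum using (inj₁; inj₂)
open import Data.List using (List; []; _∷_; map; _++_; upTo; filter; cartesianProduct)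
open import Data.List.Properties using (map-applyUpTo)
open import Data.List.Membership.Propositional using (_∈_)
open import Data.List.Membership.Propositional.Properties using (∈-filter⁺; ∈-filter⁻; ∈-cartesianProduct⁺)
open import Data.List.Membership.Propositional.Properties.WithK using (unique∧set⇒bag)
open import Data.List.Relation.Binary.BagAndSetEquality using (∼bag⇒↭)
open import Data.List.Relation.Binary.Permutation.Propositional using (↭⇒↭ₛ)
open import Data.List.Relation.Binary.Permutation.Propositional.Properties using (map⁺)
open import Data.List.Relation.Binary.Permutation.Setoid.Properties using (foldr-commMonoid)
open import Data.List.Relation.Unary.All as All using (All)
open import Data.List.Relation.Unary.AllPairs using ([]; _∷_)
open import Data.List.Relation.Unary.Any using (here; there)
open import Data.List.Relation.Unary.Unique.Propositional using (Unique)
import Data.List.Relation.Unary.Unique.Propositional.Properties as Unique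
open import Function using (id; _∘_)
open import Function.Bundles using (_⇔_; mk⇔; Equivalence)
import Function.Properties.Equivalence as ⇔
open import Level using (0ℓ)
open import Algebra.Bundles using (AbelianGroup; CommutativeMonoid; CommutativeRing)
open import Algebra.Definitions using (Congruent₂)
open import Algebra.Structures using (IsCommutativeRing)
open import Algebra.Properties.CommutativeSemigroup ℤₚ.+-commutativeSemigroup
  using () renaming (interchange to +-interchange; x∙yz≈y∙xz to +-leftComm)
open import Algebra.Properties.Group (AbelianGroup.group ℤₚ.+-0-abelianGroup)
  using () renaming (∙-cancelʳ to +-cancelʳ)
import Algebra.Solver.Ring
import Algebra.Solver.Ring.AlmostCommutativeRing as ACR
open import Relation.Nullary using (yes; no; contradiction)
open import Relation.Unary using (Decidable)
open import Relation.Binary.Core using (Rel)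
open import Relation.Binary.Definitions using (Reflexive)
open import Relation.Binary.Structures using (IsEquivalence)
open import Relation.Binary.PropositionalEquality

-- Cauchy products of integer series

shift : Series → Series
shift f k = f (suc k)

⊛-zero : ∀ f g → (f ⊛ g) 0 ≡ f 0 * g 0
⊛-zero f g = ℤₚ.+-identityʳ (f 0 * g 0)

⊛-suc : ∀ f g k → (f ⊛ g) (suc k) ≡ f 0 * g (suc k) + (shift f ⊛ g) k
⊛-suc f g k = cong (λ z → f 0 * g (suc k) + z) (cong sumℤ
  (trans (map-applyUpTo suc (λ i → f i * g (suc k ∸ i)) (suc k))
         (sym (map-applyUpTo id (λ i → f (suc i) * g (k ∸ i)) (suc k)))))

infixl 6 _⊕_
infixl 7 _·ₛ_

_⊕_ : Series → Series → Series
(f ⊕ g) k = f k + g k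

_·ₛ_ : ℤ → Series → Series
(c ·ₛ f) k = c * f k

module _ {ℓ} {_∼_ : Rel ℤ ℓ} (∼-refl : Reflexive _∼_)
         (+-cong : Congruent₂ _∼_ _+_) (*-cong : Congruent₂ _∼_ _*_) where

  sum-map-cong : ∀ {h h′ : ℕ → ℤ} → (∀ i → h i ∼ h′ i) → ∀ xs → sumℤ (map h xs) ∼ sumℤ (map h′ xs)
  sum-map-cong         h∼h′ []       = ∼-refl
  sum-map-cong {h} {h′} h∼h′ (x ∷ xs) =
    +-cong {h x} {h′ x} {sumℤ (map h xs)} {sumℤ (map h′ xs)} (h∼h′ x) (sum-map-cong h∼h′ xs)

  ⊛-cong : ∀ {f f′ g g′} → (∀ k → f k ∼ f′ k) → (∀ k → g k ∼ g′ k) → ∀ k → (f ⊛ g) k ∼ (f′ ⊛ g′) k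
  ⊛-cong {f} {f′} {g} {g′} f∼f′ g∼g′ k =
    sum-map-cong {h = λ i → f i * g (k ∸ i)} {h′ = λ i → f′ i * g′ (k ∸ i)}
                 (λ i → *-cong {f i} {f′ i} {g (k ∸ i)} {g′ (k ∸ i)} (f∼f′ i) (g∼g′ (k ∸ i)))
                 (upTo (suc k))

⊛-cong≗ : ∀ {f f′ g g′} → f ≗ f′ → g ≗ g′ → f ⊛ g ≗ f′ ⊛ g′
⊛-cong≗ {f} {f′} {g} {g′} =
  ⊛-cong (λ {a} → refl {x = a}) (λ p q → cong₂ _+_ p q) (λ p q → cong₂ _*_ p q) {f} {f′} {g} {g′}

⊛-distribʳ : ∀ f g h → (g ⊕ h) ⊛ f ≗ (g ⊛ f) ⊕ (h ⊛ f)
⊛-distribʳ f g h zero = begin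
  ((g ⊕ h) ⊛ f) 0           ≡⟨ ⊛-zero (g ⊕ h) f ⟩
  (g 0 + h 0) * f 0          ≡⟨ ℤₚ.*-distribʳ-+ (f 0) (g 0) (h 0) ⟩
  g 0 * f 0 + h 0 * f 0      ≡⟨ sym (cong₂ _+_ (⊛-zero g f) (⊛-zero h f)) ⟩
  (g ⊛ f) 0 + (h ⊛ f) 0      ∎
  where open ≡-Reasoning
⊛-distribʳ f g h (suc k) = begin
  ((g ⊕ h) ⊛ f) (suc k)
    ≡⟨ ⊛-suc (g ⊕ h) f k ⟩
  (g 0 + h 0) * f (suc k) + ((shift g ⊕ shift h) ⊛ f) k
    ≡⟨ cong₂ _+_ (ℤₚ.*-distribʳ-+ (f (suc k)) (g 0) (h 0)) (⊛-distribʳ f (shift g) (shift h) k) ⟩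
  (g 0 * f (suc k) + h 0 * f (suc k)) + ((shift g ⊛ f) k + (shift h ⊛ f) k)
    ≡⟨ +-interchange (g 0 * f (suc k)) (h 0 * f (suc k)) _ _ ⟩
  (g 0 * f (suc k) + (shift g ⊛ f) k) + (h 0 * f (suc k) + (shift h ⊛ f) k)
    ≡⟨ sym (cong₂ _+_ (⊛-suc g f k) (⊛-suc h f k)) ⟩
  (g ⊛ f) (suc k) + (h ⊛ f) (suc k) ∎
  where open ≡-Reasoning

⊛-scaleˡ : ∀ c f g → (c ·ₛ f) ⊛ g ≗ c ·ₛ (f ⊛ g)
⊛-scaleˡ c f g zero = begin
  ((c ·ₛ f) ⊛ g) 0  ≡⟨ ⊛-zero (c ·ₛ f) g ⟩
  c * f 0 * g 0     ≡⟨ ℤₚ.*-assoc c (f 0) (g 0) ⟩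
  c * (f 0 * g 0)   ≡⟨ cong (c *_) (sym (⊛-zero f g)) ⟩
  c * (f ⊛ g) 0     ∎
  where open ≡-Reasoning
⊛-scaleˡ c f g (suc k) = begin
  ((c ·ₛ f) ⊛ g) (suc k)
    ≡⟨ ⊛-suc (c ·ₛ f) g k ⟩
  c * f 0 * g (suc k) + ((c ·ₛ shift f) ⊛ g) k
    ≡⟨ cong₂ _+_ (ℤₚ.*-assoc c (f 0) (g (suc k))) (⊛-scaleˡ c (shift f) g k) ⟩
  c * (f 0 * g (suc k)) + c * (shift f ⊛ g) k   ≡⟨ sym (ℤₚ.*-distribˡ-+ c _ _) ⟩
  c * (f 0 * g (suc k) + (shift f ⊛ g) k)       ≡⟨ cong (c *_) (sym (⊛-suc f g k)) ⟩
  c * (f ⊛ g) (suc k)                           ∎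
  where open ≡-Reasoning

⊛-comm : ∀ f g → f ⊛ g ≗ g ⊛ f
⊛-comm f g zero = begin
  (f ⊛ g) 0  ≡⟨ ⊛-zero f g ⟩
  f 0 * g 0  ≡⟨ ℤₚ.*-comm (f 0) (g 0) ⟩
  g 0 * f 0  ≡⟨ sym (⊛-zero g f) ⟩
  (g ⊛ f) 0  ∎
  where open ≡-Reasoning
⊛-comm f g (suc zero) = begin
  (f ⊛ g) 1                         ≡⟨ cong (_+_ (f 0 * g 1)) (⊛-zero (shift f) g) ⟩
  f 0 * g 1 + f 1 * g 0              ≡⟨ swap (f 0) (g 1) (f 1) (g 0) ⟩
  g 0 * f 1 + g 1 * f 0              ≡⟨ cong (_+_ (g 0 * f 1)) (sym (⊛-zero (shift g) f)) ⟩
  (g ⊛ f) 1                         ∎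
  where
  open ≡-Reasoning
  open +-*-Solver
  swap : ∀ a b c d → a * b + c * d ≡ d * c + b * a
  swap = solve 4 (λ a b c d → a :* b :+ c :* d := d :* c :+ b :* a) refl
⊛-comm f g (suc (suc k)) = begin
  (f ⊛ g) k₂
    ≡⟨ ⊛-suc f g (suc k) ⟩
  f 0 * g k₂ + (shift f ⊛ g) (suc k)
    ≡⟨ cong (_+_ (f 0 * g k₂)) (trans (⊛-comm (shift f) g (suc k)) (⊛-suc g (shift f) k)) ⟩
  f 0 * g k₂ + (g 0 * f k₂ + (shift g ⊛ shift f) k)
    ≡⟨ cong (λ z → f 0 * g k₂ + (g 0 * f k₂ + z)) (⊛-comm (shift g) (shift f) k) ⟩
  f 0 * g k₂ + (g 0 * f k₂ + (shift f ⊛ shift g) k)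
    ≡⟨ +-leftComm (f 0 * g k₂) (g 0 * f k₂) _ ⟩
  g 0 * f k₂ + (f 0 * g k₂ + (shift f ⊛ shift g) k)
    ≡⟨ cong (_+_ (g 0 * f k₂)) (trans (sym (⊛-suc f (shift g) k)) (⊛-comm f (shift g) (suc k))) ⟩
  g 0 * f k₂ + (shift g ⊛ f) (suc k)
    ≡⟨ sym (⊛-suc g f (suc k)) ⟩
  (g ⊛ f) k₂ ∎
  where
  open ≡-Reasoning
  k₂ = suc (suc k)

⊛-assoc : ∀ f g h → (f ⊛ g) ⊛ h ≗ f ⊛ (g ⊛ h)
⊛-assoc f g h zero = begin
  ((f ⊛ g) ⊛ h) 0    ≡⟨ ⊛-zero (f ⊛ g) h ⟩
  (f ⊛ g) 0 * h 0    ≡⟨ cong (_* h 0) (⊛-zero f g) ⟩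
  f 0 * g 0 * h 0    ≡⟨ ℤₚ.*-assoc (f 0) (g 0) (h 0) ⟩
  f 0 * (g 0 * h 0)  ≡⟨ cong (f 0 *_) (sym (⊛-zero g h)) ⟩
  f 0 * (g ⊛ h) 0    ≡⟨ sym (⊛-zero f (g ⊛ h)) ⟩
  (f ⊛ (g ⊛ h)) 0    ∎
  where open ≡-Reasoning
⊛-assoc f g h (suc k) = begin
  ((f ⊛ g) ⊛ h) (suc k)
    ≡⟨ ⊛-suc (f ⊛ g) h k ⟩
  (f ⊛ g) 0 * h (suc k) + (shift (f ⊛ g) ⊛ h) k
    ≡⟨ cong₂ _+_ (cong (_* h (suc k)) (⊛-zero f g)) (⊛-cong≗ {g = h} (⊛-suc f g) (λ _ → refl) k) ⟩
  f 0 * g 0 * h (suc k) + ((f 0 ·ₛ shift g ⊕ shift f ⊛ g) ⊛ h) k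
    ≡⟨ cong (_+_ (f 0 * g 0 * h (suc k))) (⊛-distribʳ h (f 0 ·ₛ shift g) (shift f ⊛ g) k) ⟩
  f 0 * g 0 * h (suc k) + (((f 0 ·ₛ shift g) ⊛ h) k + ((shift f ⊛ g) ⊛ h) k)
    ≡⟨ cong₂ (λ a b → f 0 * g 0 * h (suc k) + (a + b)) (⊛-scaleˡ (f 0) (shift g) h k) (⊛-assoc (shift f) g h k) ⟩
  f 0 * g 0 * h (suc k) + (f 0 * (shift g ⊛ h) k + (shift f ⊛ (g ⊛ h)) k)
    ≡⟨ regroup (f 0) (g 0) (h (suc k)) ((shift g ⊛ h) k) ((shift f ⊛ (g ⊛ h)) k) ⟩
  f 0 * (g 0 * h (suc k) + (shift g ⊛ h) k) + (shift f ⊛ (g ⊛ h)) k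
    ≡⟨ cong (λ z → f 0 * z + (shift f ⊛ (g ⊛ h)) k) (sym (⊛-suc g h k)) ⟩
  f 0 * (g ⊛ h) (suc k) + (shift f ⊛ (g ⊛ h)) k
    ≡⟨ sym (⊛-suc f (g ⊛ h) k) ⟩
  (f ⊛ (g ⊛ h)) (suc k) ∎
  where
  open ≡-Reasoning
  open +-*-Solver
  regroup : ∀ a b c d e → a * b * c + (a * d + e) ≡ a * (b * c + d) + e
  regroup = solve 5 (λ a b c d e → a :* b :* c :+ (a :* d :+ e) := a :* (b :* c :+ d) :+ e) refl

⊛-zeroˡ : ∀ {f} g → (∀ k → f k ≡ + 0) → ∀ k → (f ⊛ g) k ≡ + 0
⊛-zeroˡ {f} g f≗0 zero    = trans (⊛-zero f g) (trans (cong (_* g 0) (f≗0 0)) (ℤₚ.*-zeroˡ (g 0)))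
⊛-zeroˡ {f} g f≗0 (suc k) = trans (⊛-suc f g k)
  (cong₂ _+_ (trans (cong (_* g (suc k)) (f≗0 0)) (ℤₚ.*-zeroˡ (g (suc k)))) (⊛-zeroˡ g (f≗0 ∘ suc) k))

⊛-identityˡ : ∀ f → oneS ⊛ f ≗ f
⊛-identityˡ f zero    = trans (⊛-zero oneS f) (ℤₚ.*-identityˡ (f 0))
⊛-identityˡ f (suc k) = trans (⊛-suc oneS f k)
  (trans (cong₂ _+_ (ℤₚ.*-identityˡ (f (suc k))) (⊛-zeroˡ f (λ _ → refl) k)) (ℤₚ.+-identityʳ (f (suc k))))

mono : ℤ → ℕ → Series
mono c zero    zero    = c
mono c zero    (suc k) = + 0
mono c (suc e) zero    = + 0
mono c (suc e) (suc k) = mono c e k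

mono-diag : ∀ c e → mono c e e ≡ c
mono-diag c zero    = refl
mono-diag c (suc e) = mono-diag c e

mono-off : ∀ c e {k} → k ≢ e → mono c e k ≡ + 0
mono-off c zero    {zero}  k≢e = contradiction refl k≢e
mono-off c zero    {suc k} k≢e = refl
mono-off c (suc e) {zero}  k≢e = refl
mono-off c (suc e) {suc k} k≢e = mono-off c e (k≢e ∘ cong suc)

mono-zero-⊛ : ∀ c g → mono c 0 ⊛ g ≗ c ·ₛ g
mono-zero-⊛ c g zero    = ⊛-zero (mono c 0) g
mono-zero-⊛ c g (suc k) = trans (⊛-suc (mono c 0) g k)
  (trans (cong (_+_ (c * g (suc k))) (⊛-zeroˡ g (λ _ → refl) k)) (ℤₚ.+-identityʳ (c * g (suc k))))

mono-suc-⊛ : ∀ c e g k → (mono c (suc e) ⊛ g) (suc k) ≡ (mono c e ⊛ g) k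
mono-suc-⊛ c e g k = trans (⊛-suc (mono c (suc e)) g k) (ℤₚ.+-identityˡ _)

mono-⊛-vanishes : ∀ c e g {k} → k < e → (mono c e ⊛ g) k ≡ + 0
mono-⊛-vanishes c (suc e) g {zero}  _         = ⊛-zero (mono c (suc e)) g
mono-⊛-vanishes c (suc e) g {suc k} (s≤s k<e) = trans (mono-suc-⊛ c e g k) (mono-⊛-vanishes c e g k<e)

mono-⊛-mono : ∀ c e c′ e′ → mono c e ⊛ mono c′ e′ ≗ mono (c * c′) (e ℕ.+ e′)
mono-⊛-mono c zero    c′ e′ k       = trans (mono-zero-⊛ c (mono c′ e′) k) (scale c e′ k)
  where
  scale : ∀ c e → c ·ₛ mono c′ e ≗ mono (c * c′) e
  scale c zero    zero    = refl
  scale c zero    (suc k) = ℤₚ.*-zeroʳ c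
  scale c (suc e) zero    = ℤₚ.*-zeroʳ c
  scale c (suc e) (suc k) = scale c e k
mono-⊛-mono c (suc e) c′ e′ zero    = ⊛-zero (mono c (suc e)) (mono c′ e′)
mono-⊛-mono c (suc e) c′ e′ (suc k) = trans (mono-suc-⊛ c e (mono c′ e′) k) (mono-⊛-mono c e c′ e′ k)

q : Series
q = mono (+ 1) 1

q^≗mono : ∀ e → powS q e ≗ mono (+ 1) e
q^≗mono zero zero    = refl
q^≗mono zero (suc k) = refl
q^≗mono (suc e) k = trans (⊛-cong≗ {q} {q} (λ _ → refl) (q^≗mono e) k) (mono-⊛-mono (+ 1) 1 (+ 1) e k)

oneMinusQ≗ : ∀ m → oneMinusQ (suc m) ≗ λ k → oneS k - mono (+ 1) (suc m) k
oneMinusQ≗ m zero    = refl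
oneMinusQ≗ m (suc k) with k ≡ᵇ m in k≡ᵇm
... | true  = sym (trans (ℤₚ.+-identityˡ _) (cong -_ (trans (cong (mono (+ 1) m) k≡m) (mono-diag (+ 1) m))))
  where k≡m = ℕₚ.≡ᵇ⇒≡ k m (subst T (sym k≡ᵇm) tt)
... | false = sym (trans (ℤₚ.+-identityˡ _) (cong -_ (mono-off (+ 1) m k≢m)))
  where k≢m = λ k≡m → subst T k≡ᵇm (ℕₚ.≡⇒≡ᵇ k m k≡m)

-- Generalized pentagonal numbers and signs

triangle : ℕ → ℕ
triangle zero    = 0
triangle (suc k) = suc k ℕ.+ triangle k

-- m(3m − 1)/2 and m(3m + 1)/2, in the shape in which they occur as exponents in Shanks' identity.
pentagonal⁻ : ℕ → ℕ
pentagonal⁻ zero    = 0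
pentagonal⁻ (suc n) = n ℕ.* suc n ℕ.+ triangle (suc n)

pentagonal⁺ : ℕ → ℕ
pentagonal⁺ m = m ℕ.* m ℕ.+ triangle m

pentagonal : ℤ → ℕ
pentagonal (+ m)    = pentagonal⁻ m
pentagonal -[1+ m ] = pentagonal⁺ (suc m)

triangle-double : ∀ k → triangle k ℕ.* 2 ≡ k ℕ.* suc k
triangle-double zero    = refl
triangle-double (suc k) = begin
  (suc k ℕ.+ triangle k) ℕ.* 2        ≡⟨ ℕₚ.*-distribʳ-+ 2 (suc k) (triangle k) ⟩
  suc k ℕ.* 2 ℕ.+ triangle k ℕ.* 2    ≡⟨ cong (λ z → suc k ℕ.* 2 ℕ.+ z) (triangle-double k) ⟩
  suc k ℕ.* 2 ℕ.+ k ℕ.* suc k         ≡⟨ lemma k ⟩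
  suc k ℕ.* suc (suc k)               ∎
  where
  open ≡-Reasoning
  lemma : ∀ k → suc k ℕ.* 2 ℕ.+ k ℕ.* suc k ≡ suc k ℕ.* suc (suc k)
  lemma = solve-∀

pentagonal⁻-double : ∀ m → pentagonal⁻ m ℕ.* 2 ℕ.+ m ≡ 3 ℕ.* (m ℕ.* m)
pentagonal⁻-double zero    = refl
pentagonal⁻-double (suc n) = begin
  (n ℕ.* suc n ℕ.+ t) ℕ.* 2 ℕ.+ suc n
    ≡⟨ cong (λ z → z ℕ.+ suc n) (ℕₚ.*-distribʳ-+ 2 (n ℕ.* suc n) t) ⟩
  n ℕ.* suc n ℕ.* 2 ℕ.+ t ℕ.* 2 ℕ.+ suc n
    ≡⟨ cong (λ z → n ℕ.* suc n ℕ.* 2 ℕ.+ z ℕ.+ suc n) (triangle-double (suc n)) ⟩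
  n ℕ.* suc n ℕ.* 2 ℕ.+ suc n ℕ.* suc (suc n) ℕ.+ suc n
    ≡⟨ lemma n ⟩
  3 ℕ.* (suc n ℕ.* suc n) ∎
  where
  open ≡-Reasoning
  t = triangle (suc n)
  lemma : ∀ n → n ℕ.* suc n ℕ.* 2 ℕ.+ suc n ℕ.* suc (suc n) ℕ.+ suc n ≡ 3 ℕ.* (suc n ℕ.* suc n)
  lemma = solve-∀

pentagonal⁺-double : ∀ m → pentagonal⁺ m ℕ.* 2 ≡ 3 ℕ.* (m ℕ.* m) ℕ.+ m
pentagonal⁺-double m = begin
  (m ℕ.* m ℕ.+ triangle m) ℕ.* 2      ≡⟨ ℕₚ.*-distribʳ-+ 2 (m ℕ.* m) (triangle m) ⟩
  m ℕ.* m ℕ.* 2 ℕ.+ triangle m ℕ.* 2  ≡⟨ cong (λ z → m ℕ.* m ℕ.* 2 ℕ.+ z) (triangle-double m) ⟩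
  m ℕ.* m ℕ.* 2 ℕ.+ m ℕ.* suc m       ≡⟨ lemma m ⟩
  3 ℕ.* (m ℕ.* m) ℕ.+ m               ∎
  where
  open ≡-Reasoning
  lemma : ∀ m → m ℕ.* m ℕ.* 2 ℕ.+ m ℕ.* suc m ≡ 3 ℕ.* (m ℕ.* m) ℕ.+ m
  lemma = solve-∀

three-squares : ∀ m → + (3 ℕ.* (m ℕ.* m)) ≡ + 3 * (+ m * + m)
three-squares m = trans (ℤₚ.pos-* 3 (m ℕ.* m)) (cong (+ 3 *_) (ℤₚ.pos-* m m))

pentagonal-double : ∀ j → j * (+ 3 * j - + 1) ≡ + (pentagonal j ℕ.* 2)
pentagonal-double (+ m) = +-cancelʳ (+ m) _ _ (begin
  + m * (+ 3 * + m - + 1) + + m     ≡⟨ lemma (+ m) ⟩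
  + 3 * (+ m * + m)                 ≡⟨ sym (three-squares m) ⟩
  + (3 ℕ.* (m ℕ.* m))               ≡⟨ cong +_ (sym (pentagonal⁻-double m)) ⟩
  + (pentagonal⁻ m ℕ.* 2 ℕ.+ m)     ≡⟨ ℤₚ.pos-+ (pentagonal⁻ m ℕ.* 2) m ⟩
  + (pentagonal⁻ m ℕ.* 2) + + m     ∎)
  where
  open ≡-Reasoning
  open +-*-Solver
  lemma : ∀ a → a * (+ 3 * a - + 1) + a ≡ + 3 * (a * a)
  lemma = solve 1 (λ a → a :* (con (+ 3) :* a :- con (+ 1)) :+ a := con (+ 3) :* (a :* a)) refl
pentagonal-double -[1+ k ] = begin
  - b * (+ 3 * - b - + 1)           ≡⟨ lemma b ⟩
  + 3 * (b * b) + b                 ≡⟨ sym (cong (_+ b) (three-squares (suc k))) ⟩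
  + (3 ℕ.* (suc k ℕ.* suc k)) + b   ≡⟨ sym (ℤₚ.pos-+ (3 ℕ.* (suc k ℕ.* suc k)) (suc k)) ⟩
  + (3 ℕ.* (suc k ℕ.* suc k) ℕ.+ suc k) ≡⟨ cong +_ (sym (pentagonal⁺-double (suc k))) ⟩
  + (pentagonal⁺ (suc k) ℕ.* 2)     ∎
  where
  open ≡-Reasoning
  open +-*-Solver
  b = + suc k
  lemma : ∀ b → - b * (+ 3 * - b - + 1) ≡ + 3 * (b * b) + b
  lemma = solve 1 (λ b → (:- b) :* (con (+ 3) :* (:- b) :- con (+ 1)) := con (+ 3) :* (b :* b) :+ b) refl

pent≡pentagonal : ∀ j → pent j ≡ + pentagonal j
pent≡pentagonal j = trans (cong (ℤ._/ + 2) (pentagonal-double j))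
                          (trans (ℤₚ.*-identityˡ _) (cong +_ (m*n/n≡m (pentagonal j) 2)))

sgn-suc : ∀ k → sgn (+ suc k) ≡ - sgn (+ k)
sgn-suc zero    = refl
sgn-suc (suc k) = trans (sym (ℤₚ.neg-involutive (sgn (+ k)))) (cong -_ (sym (sgn-suc k)))

sgn-neg : ∀ a → sgn (- a) ≡ sgn a
sgn-neg (+ zero)  = refl
sgn-neg (+ suc k) = sym (sgn-suc k)
sgn-neg -[1+ k ]  = sgn-suc k

sgn-1+ : ∀ a → sgn (+ 1 + a) ≡ - sgn a
sgn-1+ (+ k)          = sgn-suc k
sgn-1+ -[1+ zero ]    = refl
sgn-1+ -[1+ suc k ]   = sym (trans (ℤₚ.neg-involutive (sgn (+ suc k))) (sgn-suc k))

sgn-+-pos : ∀ a k → sgn (a + + k) ≡ sgn a * sgn (+ k)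
sgn-+-pos a zero    = trans (cong sgn (ℤₚ.+-identityʳ a)) (sym (ℤₚ.*-identityʳ (sgn a)))
sgn-+-pos a (suc k) = begin
  sgn (a + + suc k)       ≡⟨ cong sgn (+-suc a k) ⟩
  sgn (+ 1 + (a + + k))   ≡⟨ sgn-1+ (a + + k) ⟩
  - sgn (a + + k)         ≡⟨ cong -_ (sgn-+-pos a k) ⟩
  - (sgn a * sgn (+ k))   ≡⟨ ℤₚ.neg-distribʳ-* (sgn a) (sgn (+ k)) ⟩
  sgn a * - sgn (+ k)     ≡⟨ cong (sgn a *_) (sym (sgn-suc k)) ⟩
  sgn a * sgn (+ suc k)   ∎
  where
  open ≡-Reasoning
  open +-*-Solver
  +-suc : ∀ a k → a + + suc k ≡ + 1 + (a + + k)
  +-suc a k = trans (cong (_+_ a) (ℤₚ.pos-+ 1 k))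
                    (solve 2 (λ a b → a :+ (con (+ 1) :+ b) := con (+ 1) :+ (a :+ b)) refl a (+ k))

sgn-+ : ∀ a b → sgn (a + b) ≡ sgn a * sgn b
sgn-+ a (+ k)    = sgn-+-pos a k
sgn-+ a -[1+ k ] = begin
  sgn (a + -[1+ k ])          ≡⟨ sym (sgn-neg (a + -[1+ k ])) ⟩
  sgn (- (a + -[1+ k ]))      ≡⟨ cong sgn (ℤₚ.neg-distrib-+ a -[1+ k ]) ⟩
  sgn (- a + + suc k)         ≡⟨ sgn-+-pos (- a) (suc k) ⟩
  sgn (- a) * sgn (+ suc k)   ≡⟨ cong₂ _*_ (sgn-neg a) (sym (sgn-neg (+ suc k))) ⟩
  sgn a * sgn -[1+ k ]        ∎
  where open ≡-Reasoning

-- The representations of n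

symmetricRange : ℕ → List ℤ
symmetricRange zero    = + 0 ∷ []
symmetricRange (suc n) = + suc n ∷ -[1+ n ] ∷ symmetricRange n

∈-symmetricRange : ∀ {n j} → ℤ.∣ j ∣ ≤ n → j ∈ symmetricRange n
∈-symmetricRange {zero}  {+ zero} z≤n = here refl
∈-symmetricRange {suc n} {+ m}    m≤1+n with ℕₚ.m≤n⇒m<n∨m≡n m≤1+n
... | inj₂ refl      = here refl
... | inj₁ (s≤s m≤n) = there (there (∈-symmetricRange m≤n))
∈-symmetricRange {suc n} { -[1+ k ] } (s≤s k≤n) with ℕₚ.m≤n⇒m<n∨m≡n k≤n
... | inj₂ refl = there (here refl)
... | inj₁ k<n  = there (there (∈-symmetricRange k<n))

symmetricRange-bounded : ∀ {n j} → j ∈ symmetricRange n → ℤ.∣ j ∣ ≤ n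
symmetricRange-bounded {zero}  (here refl)         = z≤n
symmetricRange-bounded {suc n} (here refl)         = ℕₚ.≤-refl
symmetricRange-bounded {suc n} (there (here refl)) = ℕₚ.≤-refl
symmetricRange-bounded {suc n} (there (there j∈)) = ℕₚ.m≤n⇒m≤1+n (symmetricRange-bounded j∈)

symmetricRange-unique : ∀ n → Unique (symmetricRange n)
symmetricRange-unique zero    = All.[] ∷ []
symmetricRange-unique (suc n) =
  ((λ ()) All.∷ out-of-range ℕₚ.≤-refl) ∷ out-of-range ℕₚ.≤-refl ∷ symmetricRange-unique n
  where
  out-of-range : ∀ {i} → n < ℤ.∣ i ∣ → All (i ≢_) (symmetricRange n)
  out-of-range n<∣i∣ = All.tabulate λ j∈ i≡j →
    ℕₚ.<⇒≱ n<∣i∣ (subst (λ j → ℤ.∣ j ∣ ≤ n) (sym i≡j) (symmetricRange-bounded j∈))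

∣j∣≤pentagonal : ∀ j → ℤ.∣ j ∣ ≤ pentagonal j
∣j∣≤pentagonal (+ zero)  = z≤n
∣j∣≤pentagonal (+ suc k) = ℕₚ.≤-trans (ℕₚ.m≤m+n (suc k) (triangle k)) (ℕₚ.m≤n+m _ (k ℕ.* suc k))
∣j∣≤pentagonal -[1+ k ]  = ℕₚ.≤-trans (ℕₚ.m≤m+n (suc k) (triangle k)) (ℕₚ.m≤n+m _ (suc k ℕ.* suc k))

sum-map-unique : ∀ {A : Set} (f : A → ℤ) {xs ys} → Unique xs → Unique ys → (∀ {a} → a ∈ xs ⇔ a ∈ ys) →
                 sumℤ (map f xs) ≡ sumℤ (map f ys)
sum-map-unique f xs! ys! xs⇔ys = foldr-commMonoid ℤ+.setoid ℤ+.isCommutativeMonoid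
  (↭⇒↭ₛ (map⁺ f (∼bag⇒↭ (unique∧set⇒bag xs! ys! xs⇔ys))))
  where module ℤ+ = CommutativeMonoid ℤₚ.+-0-commutativeMonoid

enumerations-weightSum : ∀ {n L L′} → IsEnumeration n L → IsEnumeration n L′ → weightSum L ≡ weightSum L′
enumerations-weightSum (L! , L⇔) (L′! , L′⇔) = sum-map-unique weight L! L′! (⇔.trans (L⇔ _) (⇔.sym (L′⇔ _)))

box : ℕ → List Quad
box n = cartesianProduct js (cartesianProduct js (cartesianProduct js js))
  where js = symmetricRange n

exponent : Quad → ℕ
exponent (l , m , s , r) = 1 ℕ.* pentagonal l ℕ.+ (1 ℕ.* pentagonal m ℕ.+ (11 ℕ.* pentagonal s ℕ.+ 11 ℕ.* pentagonal r))

sign₄ : Quad → ℤ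
sign₄ (l , m , s , r) = sgn l * (sgn m * (sgn s * sgn r))

representation-value : ∀ (t : Quad) → let (l , m , s , r) = t in
  pent l + pent m + + 11 * pent s + + 11 * pent r ≡ + exponent t
representation-value (l , m , s , r)
  rewrite pent≡pentagonal l | pent≡pentagonal m | pent≡pentagonal s | pent≡pentagonal r =
  sym (cast (pentagonal l) (pentagonal m) (pentagonal s) (pentagonal r))
  where
  open +-*-Solver
  cast : ∀ a b c d → + (1 ℕ.* a ℕ.+ (1 ℕ.* b ℕ.+ (11 ℕ.* c ℕ.+ 11 ℕ.* d))) ≡ + a + + b + + 11 * + c + + 11 * + d
  cast a b c d = begin
    + (1 ℕ.* a ℕ.+ (1 ℕ.* b ℕ.+ (11 ℕ.* c ℕ.+ 11 ℕ.* d)))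
      ≡⟨ trans (ℤₚ.pos-+ (1 ℕ.* a) _) (cong₂ _+_ (ℤₚ.pos-* 1 a) (trans (ℤₚ.pos-+ (1 ℕ.* b) _)
           (cong₂ _+_ (ℤₚ.pos-* 1 b) (trans (ℤₚ.pos-+ (11 ℕ.* c) _) (cong₂ _+_ (ℤₚ.pos-* 11 c) (ℤₚ.pos-* 11 d)))))) ⟩
    + 1 * + a + (+ 1 * + b + (+ 11 * + c + + 11 * + d))
      ≡⟨ solve 4 (λ a b c d → con (+ 1) :* a :+ (con (+ 1) :* b :+ (con (+ 11) :* c :+ con (+ 11) :* d)) :=
                             a :+ b :+ con (+ 11) :* c :+ con (+ 11) :* d) refl (+ a) (+ b) (+ c) (+ d) ⟩
    + a + + b + + 11 * + c + + 11 * + d ∎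
    where open ≡-Reasoning

IsRep⇔ : ∀ n t → IsRep n t ⇔ n ≡ exponent t
IsRep⇔ n t = mk⇔ (λ rep → ℤₚ.+-injective (trans rep (representation-value t)))
                 (λ n≡e → trans (cong +_ n≡e) (sym (representation-value t)))

IsRep? : ∀ n → Decidable (IsRep n)
IsRep? n (l , m , s , r) = + n ℤₚ.≟ (pent l + pent m + + 11 * pent s + + 11 * pent r)

sign₄≡weight : ∀ t → sign₄ t ≡ weight t
sign₄≡weight (l , m , s , r) = sym (begin
  sgn (l + m + s + r)                    ≡⟨ sgn-+ (l + m + s) r ⟩
  sgn (l + m + s) * sgn r                ≡⟨ cong (_* sgn r) (trans (sgn-+ (l + m) s) (cong (_* sgn s) (sgn-+ l m))) ⟩
  sgn l * sgn m * sgn s * sgn r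
    ≡⟨ solve 4 (λ a b c d → a :* b :* c :* d := a :* (b :* (c :* d))) refl (sgn l) (sgn m) (sgn s) (sgn r) ⟩
  sgn l * (sgn m * (sgn s * sgn r))      ∎)
  where
  open ≡-Reasoning
  open +-*-Solver

coefficient-∑ : ∀ n xs → sumℤ (map (λ t → mono (sign₄ t) (exponent t) n) xs) ≡ weightSum (filter (IsRep? n) xs)
coefficient-∑ n []       = refl
coefficient-∑ n (t ∷ xs) with IsRep? n t
... | yes rep = cong₂ _+_ (trans (cong (mono (sign₄ t) (exponent t)) (Equivalence.to (IsRep⇔ n t) rep))
                                 (trans (mono-diag (sign₄ t) (exponent t)) (sign₄≡weight t)))
                          (coefficient-∑ n xs)
... | no ¬rep = trans (cong₂ _+_ (mono-off (sign₄ t) (exponent t) (¬rep ∘ Equivalence.from (IsRep⇔ n t)))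
                                 (coefficient-∑ n xs))
                      (ℤₚ.+-identityˡ _)

box-complete : ∀ {n t} → IsRep n t → t ∈ box n
box-complete {n} {t@(l , m , s , r)} rep =
  ∈-cartesianProduct⁺ (in-range l l≤) (∈-cartesianProduct⁺ (in-range m m≤)
    (∈-cartesianProduct⁺ (in-range s s≤) (in-range r r≤)))
  where
  in-range : ∀ j → pentagonal j ≤ exponent t → j ∈ symmetricRange n
  in-range j p≤e = ∈-symmetricRange (ℕₚ.≤-trans (∣j∣≤pentagonal j)
    (subst (pentagonal j ≤_) (sym (Equivalence.to (IsRep⇔ n t) rep)) p≤e))
  factor : ∀ c {a b} .{{_ : NonZero c}} → c ℕ.* a ≤ b → a ≤ b
  factor c {a} = ℕₚ.≤-trans (ℕₚ.m≤n*m a c)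
  E₃ = 11 ℕ.* pentagonal s ℕ.+ 11 ℕ.* pentagonal r
  E₂ = 1 ℕ.* pentagonal m ℕ.+ E₃
  E₂≤e : E₂ ≤ exponent t
  E₂≤e = ℕₚ.m≤n+m E₂ (1 ℕ.* pentagonal l)
  E₃≤e : E₃ ≤ exponent t
  E₃≤e = ℕₚ.≤-trans (ℕₚ.m≤n+m E₃ (1 ℕ.* pentagonal m)) E₂≤e
  l≤ = factor 1 (ℕₚ.m≤m+n (1 ℕ.* pentagonal l) E₂)
  m≤ = factor 1 (ℕₚ.≤-trans (ℕₚ.m≤m+n (1 ℕ.* pentagonal m) E₃) E₂≤e)
  s≤ = factor 11 (ℕₚ.≤-trans (ℕₚ.m≤m+n (11 ℕ.* pentagonal s) (11 ℕ.* pentagonal r)) E₃≤e)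
  r≤ = factor 11 (ℕₚ.≤-trans (ℕₚ.m≤n+m (11 ℕ.* pentagonal r) (11 ℕ.* pentagonal s)) E₃≤e)

representations : ℕ → List Quad
representations n = filter (IsRep? n) (box n)

representations-enumerate : ∀ n → IsEnumeration n (representations n)
representations-enumerate n =
  Unique.filter⁺ (IsRep? n)
    (Unique.cartesianProduct⁺ js! (Unique.cartesianProduct⁺ js! (Unique.cartesianProduct⁺ js! js!))) ,
  λ t → mk⇔ (proj₂ ∘ ∈-filter⁻ (IsRep? n) {xs = box n}) (λ rep → ∈-filter⁺ (IsRep? n) (box-complete rep) rep)
  where js! = symmetricRange-unique n

-- Integer series modulo d form a commutative ring

infix 4 _≡_mod_
record _≡_mod_ (a b d : ℤ) : Set where
  constructor mod≡
  field ∣-difference : d ℤ∣.∣ a - b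
open _≡_mod_ public

module _ {d : ℤ} where
  open +-*-Solver

  ≡⇒≡-mod : ∀ {a b} → a ≡ b → a ≡ b mod d
  ≡⇒≡-mod {a} refl = mod≡ (divides (+ 0) (ℤₚ.+-inverseʳ a))

  ≡-mod-sym : ∀ {a b} → a ≡ b mod d → b ≡ a mod d
  ≡-mod-sym {a} {b} (mod≡ p) = mod≡ (subst (d ℤ∣.∣_) (neg-diff a b) (ℤ∣.∣m⇒∣-m p))
    where neg-diff : ∀ a b → - (a - b) ≡ b - a
          neg-diff = solve 2 (λ a b → :- (a :- b) := b :- a) refl

  ≡-mod-trans : ∀ {a b c} → a ≡ b mod d → b ≡ c mod d → a ≡ c mod d
  ≡-mod-trans {a} {b} {c} (mod≡ p) (mod≡ q) = mod≡ (subst (d ℤ∣.∣_) (diff-trans a b c) (ℤ∣.∣m∣n⇒∣m+n p q))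
    where diff-trans : ∀ a b c → (a - b) + (b - c) ≡ a - c
          diff-trans = solve 3 (λ a b c → (a :- b) :+ (b :- c) := a :- c) refl

  +-cong-mod : ∀ {a a′ b b′} → a ≡ a′ mod d → b ≡ b′ mod d → a + b ≡ a′ + b′ mod d
  +-cong-mod {a} {a′} {b} {b′} (mod≡ p) (mod≡ q) = mod≡ (subst (d ℤ∣.∣_) (diff-+ a a′ b b′) (ℤ∣.∣m∣n⇒∣m+n p q))
    where diff-+ : ∀ a a′ b b′ → (a - a′) + (b - b′) ≡ (a + b) - (a′ + b′)
          diff-+ = solve 4 (λ a a′ b b′ → (a :- a′) :+ (b :- b′) := (a :+ b) :- (a′ :+ b′)) refl

  -‿cong-mod : ∀ {a a′} → a ≡ a′ mod d → - a ≡ - a′ mod d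
  -‿cong-mod {a} {a′} (mod≡ p) = mod≡ (subst (d ℤ∣.∣_) (diff-neg a a′) (ℤ∣.∣m⇒∣-m p))
    where diff-neg : ∀ a a′ → - (a - a′) ≡ (- a) - (- a′)
          diff-neg = solve 2 (λ a a′ → :- (a :- a′) := (:- a) :- (:- a′)) refl

  *-cong-mod : ∀ {a a′ b b′} → a ≡ a′ mod d → b ≡ b′ mod d → a * b ≡ a′ * b′ mod d
  *-cong-mod {a} {a′} {b} {b′} (mod≡ p) (mod≡ q) =
    mod≡ (subst (d ℤ∣.∣_) (diff-* a a′ b b′) (ℤ∣.∣m∣n⇒∣m+n (ℤ∣.∣m⇒∣m*n b p) (ℤ∣.∣n⇒∣m*n a′ q)))
    where diff-* : ∀ a a′ b b′ → (a - a′) * b + a′ * (b - b′) ≡ a * b - a′ * b′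
          diff-* = solve 4 (λ a a′ b b′ → (a :- a′) :* b :+ a′ :* (b :- b′) := a :* b :- a′ :* b′) refl

-- Opaque so that unification treats the ring operations as heads rather than η-expanding
-- series into their coefficient sums.
opaque
  infixl 6 _+ₛ_
  infixl 7 _*ₛ_
  infix  8 -ₛ_

  _+ₛ_ : Series → Series → Series
  _+ₛ_ = _⊕_

  _*ₛ_ : Series → Series → Series
  _*ₛ_ = _⊛_

  -ₛ_ : Series → Series
  (-ₛ f) k = - f k

  0ₛ : Series
  0ₛ _ = + 0

  1ₛ : Series
  1ₛ = oneS

  +ₛ-coeff : ∀ f g k → (f +ₛ g) k ≡ f k + g k
  +ₛ-coeff f g k = refl

  *ₛ-coeff : ∀ f g k → (f *ₛ g) k ≡ (f ⊛ g) k
  *ₛ-coeff f g k = refl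

  -ₛ-coeff : ∀ f k → (-ₛ f) k ≡ - f k
  -ₛ-coeff f k = refl

  0ₛ-coeff : ∀ k → 0ₛ k ≡ + 0
  0ₛ-coeff k = refl

  1ₛ-coeff : ∀ k → 1ₛ k ≡ oneS k
  1ₛ-coeff k = refl

infixl 6 _-ₛ_
_-ₛ_ : Series → Series → Series
f -ₛ g = f +ₛ -ₛ g

-- The constants of the ring solver; 0 and 1 go to 0ₛ and 1ₛ on the nose, so that normal
-- forms can be compared syntactically.
cst : ℤ → Series
cst (+ 0) = 0ₛ
cst (+ 1) = 1ₛ
cst c     = c ·ₛ oneS

module SeriesMod (d : ℤ) where

  infix 4 _≈_
  record _≈_ (f g : Series) : Set where
    constructor coeffwise
    field coeff : ∀ k → f k ≡ g k mod d
  open _≈_ public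

  ≗⇒≈ : ∀ {f g} → f ≗ g → f ≈ g
  ≗⇒≈ f≗g = coeffwise (λ k → ≡⇒≡-mod (f≗g k))

  ≈-isEquivalence : IsEquivalence _≈_
  ≈-isEquivalence = record
    { refl  = coeffwise (λ k → ≡⇒≡-mod refl)
    ; sym   = λ f≈g → coeffwise (λ k → ≡-mod-sym (coeff f≈g k))
    ; trans = λ f≈g g≈h → coeffwise (λ k → ≡-mod-trans (coeff f≈g k) (coeff g≈h k))
    }

  opaque
    unfolding _+ₛ_ _*ₛ_ -ₛ_ 0ₛ 1ₛ

    isCommutativeRing : IsCommutativeRing _≈_ _+ₛ_ _*ₛ_ -ₛ_ 0ₛ 1ₛ
    isCommutativeRing = record
      { isRing = record
        { +-isAbelianGroup = record
          { isGroup = record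
            { isMonoid = record
              { isSemigroup = record
                { isMagma = record
                  { isEquivalence = ≈-isEquivalence
                  ; ∙-cong = λ f≈f′ g≈g′ → coeffwise (λ k → +-cong-mod (coeff f≈f′ k) (coeff g≈g′ k)) }
                ; assoc = λ f g h → ≗⇒≈ (λ k → ℤₚ.+-assoc (f k) (g k) (h k)) }
              ; identity = (λ f → ≗⇒≈ (λ k → ℤₚ.+-identityˡ (f k))) , (λ f → ≗⇒≈ (λ k → ℤₚ.+-identityʳ (f k))) }
            ; inverse = (λ f → ≗⇒≈ (λ k → ℤₚ.+-inverseˡ (f k))) , (λ f → ≗⇒≈ (λ k → ℤₚ.+-inverseʳ (f k)))
            ; ⁻¹-cong = λ f≈f′ → coeffwise (λ k → -‿cong-mod (coeff f≈f′ k)) }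
          ; comm = λ f g → ≗⇒≈ (λ k → ℤₚ.+-comm (f k) (g k)) }
        ; *-cong = λ {f} {f′} {g} {g′} f≈f′ g≈g′ →
            coeffwise (⊛-cong (λ {a} → ≡⇒≡-mod (refl {x = a})) +-cong-mod *-cong-mod {f} {f′} {g} {g′}
                              (coeff f≈f′) (coeff g≈g′))
        ; *-assoc = λ f g h → ≗⇒≈ (⊛-assoc f g h)
        ; *-identity = (λ f → ≗⇒≈ (⊛-identityˡ f)) , (λ f → ≗⇒≈ (λ k → trans (⊛-comm f oneS k) (⊛-identityˡ f k)))
        ; distrib = (λ f g h → ≗⇒≈ (λ k → trans (⊛-comm f (g ⊕ h) k)
                                 (trans (⊛-distribʳ f g h k) (cong₂ _+_ (⊛-comm g f k) (⊛-comm h f k)))))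
                  , (λ f g h → ≗⇒≈ (⊛-distribʳ f g h)) }
      ; *-comm = λ f g → ≗⇒≈ (⊛-comm f g) }

    cst≈ : ∀ c → cst c ≈ c ·ₛ oneS
    cst≈ (+ 0)           = ≗⇒≈ (λ k → sym (ℤₚ.*-zeroˡ (oneS k)))
    cst≈ (+ 1)           = ≗⇒≈ (λ k → sym (ℤₚ.*-identityˡ (oneS k)))
    cst≈ (+ suc (suc n)) = ≗⇒≈ (λ k → refl)
    cst≈ (ℤ.-[1+ n ])    = ≗⇒≈ (λ k → refl)

    private
      scale-+ : ∀ a b → (a + b) ·ₛ oneS ≈ (a ·ₛ oneS) +ₛ (b ·ₛ oneS)
      scale-+ a b = ≗⇒≈ (λ k → ℤₚ.*-distribʳ-+ (oneS k) a b)

      scale-* : ∀ a b → (a * b) ·ₛ oneS ≈ (a ·ₛ oneS) *ₛ (b ·ₛ oneS)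
      scale-* a b = ≗⇒≈ (λ k → begin
        a * b * oneS k                ≡⟨ ℤₚ.*-assoc a b (oneS k) ⟩
        a * (b * oneS k)              ≡⟨ cong (a *_) (⊛-identityˡ (b ·ₛ oneS) k) ⟨
        a * (oneS ⊛ (b ·ₛ oneS)) k    ≡⟨ ⊛-scaleˡ a oneS (b ·ₛ oneS) k ⟨
        ((a ·ₛ oneS) ⊛ (b ·ₛ oneS)) k ∎)
        where open ≡-Reasoning

      scale-neg : ∀ a → (- a) ·ₛ oneS ≈ -ₛ (a ·ₛ oneS)
      scale-neg a = ≗⇒≈ (λ k → sym (ℤₚ.neg-distribˡ-* a (oneS k)))

  ring : CommutativeRing 0ℓ 0ℓ
  ring = record { isCommutativeRing = isCommutativeRing }

  private module R = CommutativeRing ring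

  cst-morphism : CommutativeRing.rawRing ℤₚ.+-*-commutativeRing
                   ACR.-Raw-AlmostCommutative⟶ ACR.fromCommutativeRing ring
  cst-morphism = record
    { ⟦_⟧    = cst
    ; +-homo = λ a b → R.trans (cst≈ (a + b)) (R.trans (scale-+ a b) (R.sym (R.+-cong (cst≈ a) (cst≈ b))))
    ; *-homo = λ a b → R.trans (cst≈ (a * b)) (R.trans (scale-* a b) (R.sym (R.*-cong (cst≈ a) (cst≈ b))))
    ; -‿homo = λ a → R.trans (cst≈ (- a)) (R.trans (scale-neg a) (R.sym (R.-‿cong (cst≈ a))))
    ; 0-homo = R.refl
    ; 1-homo = R.refl
    }

  _≟cst_ : ∀ a b → Maybe (cst a ≈ cst b)
  a ≟cst b with a ℤₚ.≟ b
  ... | yes refl = just R.refl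
  ... | no _     = nothing

  open Algebra.Solver.Ring _ (ACR.fromCommutativeRing ring) cst-morphism _≟cst_ public
    using (solve; _:=_; con; _:+_; _:*_; _:-_; :-_; Polynomial)

  open import Algebra.Properties.Semiring.Exp R.semiring using (_^_)

  ⊛≈*ₛ : ∀ f g → f ⊛ g ≈ f *ₛ g
  ⊛≈*ₛ f g = ≗⇒≈ (λ k → sym (*ₛ-coeff f g k))

  powS≈^ : ∀ f e → powS f e ≈ f ^ e
  powS≈^ f zero    = ≗⇒≈ (λ k → sym (1ₛ-coeff k))
  powS≈^ f (suc e) = R.trans (⊛≈*ₛ f (powS f e)) (R.*-cong R.refl (powS≈^ f e))

  q^≈mono : ∀ e → q ^ e ≈ mono (+ 1) e
  q^≈mono e = R.trans (R.sym (powS≈^ q e)) (≗⇒≈ (q^≗mono e))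

  oneMinusQ≈ : ∀ m → oneMinusQ (suc m) ≈ 1ₛ -ₛ q ^ suc m
  oneMinusQ≈ m = R.trans (≗⇒≈ λ k → trans (oneMinusQ≗ m k)
                   (sym (trans (+ₛ-coeff 1ₛ _ k) (cong₂ _+_ (1ₛ-coeff k) (-ₛ-coeff _ k)))))
                 (R.+-cong R.refl (R.-‿cong (R.sym (q^≈mono (suc m)))))

  modulus≈0 : cst d ≈ 0ₛ
  modulus≈0 = R.trans (cst≈ d) (coeffwise λ k → mod≡ (subst (d ℤ∣.∣_)
    (sym (trans (cong (λ z → d * oneS k - z) (0ₛ-coeff k)) (ℤₚ.+-identityʳ _)))
    (ℤ∣.∣m⇒∣m*n (oneS k) ℤ∣.∣-refl)))

  infix 4 _≈_mod⟨_⟩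
  record _≈_mod⟨_⟩ (f g y : Series) : Set where
    constructor _,_
    field
      quotient : Series
      equation : f ≈ g +ₛ y *ₛ quotient

  ≈⇒≈-mod⟨⟩ : ∀ {f g} y → f ≈ g → f ≈ g mod⟨ y ⟩
  ≈⇒≈-mod⟨⟩ {f} {g} y f≈g = 0ₛ , R.trans f≈g (solve 2 (λ g y → g := g :+ y :* con (+ 0)) R.refl g y)

  mod⟨⟩-transˡ : ∀ {f g h y} → f ≈ g → g ≈ h mod⟨ y ⟩ → f ≈ h mod⟨ y ⟩
  mod⟨⟩-transˡ f≈g (H , g≈) = H , R.trans f≈g g≈

  mod⟨⟩-divisor : ∀ {f g y y′} z → y′ ≈ y *ₛ z → f ≈ g mod⟨ y′ ⟩ → f ≈ g mod⟨ y ⟩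
  mod⟨⟩-divisor {g = g} {y} {y′} z y′≈ (h , f≈) = z *ₛ h , R.trans f≈ (R.+-cong R.refl (begin
    y′ *ₛ h          ≈⟨ R.*-cong y′≈ R.refl ⟩
    (y *ₛ z) *ₛ h    ≈⟨ R.*-assoc y z h ⟩
    y *ₛ (z *ₛ h)    ∎))
    where open import Relation.Binary.Reasoning.Setoid R.setoid

  mod⟨⟩-*-cong : ∀ {f f′ g g′ y} → f ≈ f′ mod⟨ y ⟩ → g ≈ g′ mod⟨ y ⟩ → f *ₛ g ≈ f′ *ₛ g′ mod⟨ y ⟩
  mod⟨⟩-*-cong {f} {f′} {g} {g′} {y} (F , f≈) (G , g≈) = F *ₛ g′ +ₛ f′ *ₛ G +ₛ y *ₛ (F *ₛ G) , (begin
    f *ₛ g                               ≈⟨ R.*-cong f≈ g≈ ⟩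
    (f′ +ₛ y *ₛ F) *ₛ (g′ +ₛ y *ₛ G)     ≈⟨ solve 5 (λ f g y F G → (f :+ y :* F) :* (g :+ y :* G) :=
                                               f :* g :+ y :* (F :* g :+ f :* G :+ y :* (F :* G))) R.refl f′ g′ y F G ⟩
    f′ *ₛ g′ +ₛ y *ₛ (F *ₛ g′ +ₛ f′ *ₛ G +ₛ y *ₛ (F *ₛ G)) ∎)
    where open import Relation.Binary.Reasoning.Setoid R.setoid

  mod⟨⟩-^-cong : ∀ {f g y} → f ≈ g mod⟨ y ⟩ → ∀ k → f ^ k ≈ g ^ k mod⟨ y ⟩
  mod⟨⟩-^-cong {y = y} f≈g zero    = ≈⇒≈-mod⟨⟩ y R.refl
  mod⟨⟩-^-cong         f≈g (suc k) = mod⟨⟩-*-cong f≈g (mod⟨⟩-^-cong f≈g k)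

  mod⟨q^⟩-coeff : ∀ {f g m k} → f ≈ g mod⟨ q ^ m ⟩ → k < m → f k ≡ g k mod d
  mod⟨q^⟩-coeff {f} {g} {m} {k} (h , f≈) k<m =
    ≡-mod-trans (coeff f≈ k) (≡-mod-trans (≡⇒≡-mod (+ₛ-coeff g _ k))
      (≡-mod-trans (+-cong-mod (≡⇒≡-mod (refl {x = g k})) vanishes) (≡⇒≡-mod (ℤₚ.+-identityʳ (g k)))))
    where
    vanishes : ((q ^ m) *ₛ h) k ≡ + 0 mod d
    vanishes = ≡-mod-trans (coeff (R.*-cong (q^≈mono m) R.refl) k)
                 (≡⇒≡-mod (trans (*ₛ-coeff _ h k) (mono-⊛-vanishes (+ 1) m h k<m)))

  ∑ : {A : Set} → List A → (A → Series) → Series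
  ∑ []       f = 0ₛ
  ∑ (a ∷ as) f = f a +ₛ ∑ as f

  syntax ∑ xs (λ a → e) = ∑[ a ∈ xs ] e

  module _ {A : Set} where

    ∑-cong : ∀ (xs : List A) {f g} → (∀ a → f a ≈ g a) → ∑ xs f ≈ ∑ xs g
    ∑-cong []       f≈g = R.refl
    ∑-cong (a ∷ as) f≈g = R.+-cong (f≈g a) (∑-cong as f≈g)

    ∑-++ : ∀ (xs ys : List A) f → ∑ (xs ++ ys) f ≈ ∑ xs f +ₛ ∑ ys f
    ∑-++ []       ys f = R.sym (R.+-identityˡ (∑ ys f))
    ∑-++ (a ∷ as) ys f = R.trans (R.+-cong R.refl (∑-++ as ys f)) (R.sym (R.+-assoc (f a) (∑ as f) (∑ ys f)))

    ∑-distribˡ : ∀ (xs : List A) y f → y *ₛ ∑ xs f ≈ ∑[ a ∈ xs ] (y *ₛ f a)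
    ∑-distribˡ []       y f = R.zeroʳ y
    ∑-distribˡ (a ∷ as) y f = R.trans (R.distribˡ y (f a) (∑ as f)) (R.+-cong R.refl (∑-distribˡ as y f))

    ∑-coeff : ∀ (xs : List A) f k → ∑ xs f k ≡ sumℤ (map (λ a → f a k) xs)
    ∑-coeff []       f k = 0ₛ-coeff k
    ∑-coeff (a ∷ as) f k = trans (+ₛ-coeff (f a) (∑ as f) k) (cong (_+_ (f a k)) (∑-coeff as f k))

  ∑-map : ∀ {A B : Set} (h : A → B) xs f → ∑ (map h xs) f ≡ ∑[ a ∈ xs ] f (h a)
  ∑-map h []       f = refl
  ∑-map h (a ∷ as) f = cong (f (h a) +ₛ_) (∑-map h as f)

  ∑-*-∑ : ∀ {A B : Set} (xs : List A) (ys : List B) f g →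
          ∑ xs f *ₛ ∑ ys g ≈ ∑[ (a , b) ∈ cartesianProduct xs ys ] (f a *ₛ g b)
  ∑-*-∑ []       ys f g = R.zeroˡ (∑ ys g)
  ∑-*-∑ (a ∷ as) ys f g = begin
    (f a +ₛ ∑ as f) *ₛ ∑ ys g
      ≈⟨ R.distribʳ (∑ ys g) (f a) (∑ as f) ⟩
    f a *ₛ ∑ ys g +ₛ ∑ as f *ₛ ∑ ys g
      ≈⟨ R.+-cong (R.trans (∑-distribˡ ys (f a) g) (R.reflexive (sym (∑-map (a ,_) ys _)))) (∑-*-∑ as ys f g) ⟩
    ∑ (map (a ,_) ys) _ +ₛ ∑ (cartesianProduct as ys) _
      ≈⟨ R.sym (∑-++ (map (a ,_) ys) (cartesianProduct as ys) _) ⟩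
    ∑ (cartesianProduct (a ∷ as) ys) _ ∎
    where
    open import Relation.Binary.Reasoning.Setoid R.setoid

  cst≈mono : ∀ a → cst a ≈ mono a 0
  cst≈mono a = R.trans (cst≈ a) (≗⇒≈ λ { zero → ℤₚ.*-identityʳ a ; (suc k) → ℤₚ.*-zeroʳ a })

  mono-*ₛ-mono : ∀ a e b e′ → mono a e *ₛ mono b e′ ≈ mono (a * b) (e ℕ.+ e′)
  mono-*ₛ-mono a e b e′ = ≗⇒≈ (λ k → trans (*ₛ-coeff _ _ k) (mono-⊛-mono a e b e′ k))

-- Shanks' identity: a finite form of Euler's pentagonal theorem

module FinitePentagonal (d : ℤ) (x : Series) where

  open SeriesMod d
  private module R = CommutativeRing ring
  open import Algebra.Properties.Semiring.Exp R.semiring using (_^_; ^-homo-*; ^-congʳ)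
  open import Relation.Binary.Reasoning.Setoid R.setoid

  sign : ℕ → Series
  sign zero    = 1ₛ
  sign (suc k) = -ₛ sign k

  pochhammer : ℕ → ℕ → Series
  pochhammer a zero    = 1ₛ
  pochhammer a (suc r) = pochhammer a r *ₛ (1ₛ -ₛ x ^ (a ℕ.+ r))

  pentagonalSum : ℕ → Series
  pentagonalSum zero    = 1ₛ
  pentagonalSum (suc n) = pentagonalSum n +ₛ sign (suc n) *ₛ ((x ^ pentagonal⁻ (suc n)) +ₛ (x ^ pentagonal⁺ (suc n)))

  ∑< : ℕ → (ℕ → Series) → Series
  ∑< zero    f = 0ₛ
  ∑< (suc m) f = ∑< m f +ₛ f m

  ∑<-cong : ∀ m {f g} → (∀ k → k < m → f k ≈ g k) → ∑< m f ≈ ∑< m g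
  ∑<-cong zero    f≈g = R.refl
  ∑<-cong (suc m) f≈g = R.+-cong (∑<-cong m (λ k k<m → f≈g k (ℕₚ.m≤n⇒m≤1+n k<m))) (f≈g m ℕₚ.≤-refl)

  ∑<-distrib-+ : ∀ m f g → ∑< m (λ k → f k +ₛ g k) ≈ ∑< m f +ₛ ∑< m g
  ∑<-distrib-+ zero    f g = R.sym (R.+-identityˡ 0ₛ)
  ∑<-distrib-+ (suc m) f g = begin
    ∑< m (λ k → f k +ₛ g k) +ₛ (f m +ₛ g m)  ≈⟨ R.+-cong (∑<-distrib-+ m f g) R.refl ⟩
    (∑< m f +ₛ ∑< m g) +ₛ (f m +ₛ g m)       ≈⟨ solve 4 (λ a b c e → (a :+ b) :+ (c :+ e) := (a :+ c) :+ (b :+ e)) R.refl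
                                                  (∑< m f) (∑< m g) (f m) (g m) ⟩
    (∑< m f +ₛ f m) +ₛ (∑< m g +ₛ g m)       ∎

  ∑<-telescope : ∀ m (w : ℕ → Series) → ∑< m (λ k → w k -ₛ w (suc k)) ≈ w 0 -ₛ w m
  ∑<-telescope zero    w = R.sym (R.-‿inverseʳ (w 0))
  ∑<-telescope (suc m) w = begin
    ∑< m (λ k → w k -ₛ w (suc k)) +ₛ (w m -ₛ w (suc m)) ≈⟨ R.+-cong (∑<-telescope m w) R.refl ⟩
    (w 0 -ₛ w m) +ₛ (w m -ₛ w (suc m))                 ≈⟨ solve 3 (λ a b c → (a :- b) :+ (b :- c) := a :- c) R.refl
                                                             (w 0) (w m) (w (suc m)) ⟩
    w 0 -ₛ w (suc m)                                   ∎

  ∑<-front : ∀ m f → ∑< (suc m) f ≈ f 0 +ₛ ∑< m (λ k → f (suc k))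
  ∑<-front zero    f = R.trans (R.+-identityˡ (f 0)) (R.sym (R.+-identityʳ (f 0)))
  ∑<-front (suc m) f = R.trans (R.+-cong (∑<-front m f) R.refl) (R.+-assoc (f 0) _ _)

  ∑<-distribˡ : ∀ m y f → ∑< m (λ k → y *ₛ f k) ≈ y *ₛ ∑< m f
  ∑<-distribˡ zero    y f = R.sym (R.zeroʳ y)
  ∑<-distribˡ (suc m) y f = R.trans (R.+-cong (∑<-distribˡ m y f) R.refl) (R.sym (R.distribˡ y (∑< m f) (f m)))

  pochhammer-front : ∀ a r → pochhammer a (suc r) ≈ (1ₛ -ₛ x ^ a) *ₛ pochhammer (suc a) r
  pochhammer-front a zero = begin
    1ₛ *ₛ (1ₛ -ₛ x ^ (a ℕ.+ 0)) ≈⟨ R.*-cong R.refl (R.+-cong R.refl (R.-‿cong (^-congʳ x (ℕₚ.+-identityʳ a)))) ⟩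
    1ₛ *ₛ (1ₛ -ₛ x ^ a)         ≈⟨ R.*-comm 1ₛ _ ⟩
    (1ₛ -ₛ x ^ a) *ₛ 1ₛ         ∎
  pochhammer-front a (suc r) = begin
    pochhammer a (suc r) *ₛ (1ₛ -ₛ x ^ (a ℕ.+ suc r))
      ≈⟨ R.*-cong (pochhammer-front a r) (R.+-cong R.refl (R.-‿cong (^-congʳ x (ℕₚ.+-suc a r)))) ⟩
    ((1ₛ -ₛ x ^ a) *ₛ pochhammer (suc a) r) *ₛ (1ₛ -ₛ x ^ (suc a ℕ.+ r))
      ≈⟨ R.*-assoc _ _ _ ⟩
    (1ₛ -ₛ x ^ a) *ₛ pochhammer (suc a) (suc r) ∎

  pochhammer-cong : ∀ a {r r′} → r ≡ r′ → pochhammer a r ≈ pochhammer a r′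
  pochhammer-cong a refl = R.refl

  -- Shanks: Σ_{k ≤ n} (−1)ᵏ x^(nk + k(k+1)/2) (x^(k+1); x)_(n−k) is the truncated pentagonal
  -- sum.  Passing from n to n + 1 changes the k-th term by a difference of consecutive
  -- corrections, which telescopes.
  shanksTerm : ℕ → ℕ → Series
  shanksTerm n k = sign k *ₛ ((x ^ (n ℕ.* k ℕ.+ triangle k)) *ₛ pochhammer (suc k) (n ∸ k))

  shanksCorrection : ℕ → ℕ → Series
  shanksCorrection n zero    = 0ₛ
  shanksCorrection n (suc k) = sign k *ₛ ((x ^ (n ℕ.* suc k ℕ.+ triangle (suc k))) *ₛ pochhammer (suc k) (n ∸ k))

  shanksTerm-zero : ∀ n → shanksTerm n 0 ≈ pochhammer 1 n
  shanksTerm-zero n = R.trans (R.*-cong R.refl (R.*-cong (^-congʳ x n*0+0≡0) R.refl))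
                              (solve 1 (λ p → con (+ 1) :* (con (+ 1) :* p) := p) R.refl (pochhammer 1 n))
    where n*0+0≡0 = trans (ℕₚ.+-identityʳ (n ℕ.* 0)) (ℕₚ.*-zeroʳ n)

  shanksTerm-suc₀ : ∀ n → shanksTerm (suc n) 0 ≈ shanksTerm n 0 +ₛ (shanksCorrection n 0 -ₛ shanksCorrection n 1)
  shanksTerm-suc₀ n = begin
    shanksTerm (suc n) 0
      ≈⟨ shanksTerm-zero (suc n) ⟩
    pochhammer 1 n *ₛ (1ₛ -ₛ x ^ suc n)
      ≈⟨ solve 2 (λ p y → p :* (con (+ 1) :- y) := p :+ (con (+ 0) :- con (+ 1) :* (y :* p)))
                 R.refl (pochhammer 1 n) (x ^ suc n) ⟩
    pochhammer 1 n +ₛ (0ₛ -ₛ 1ₛ *ₛ ((x ^ suc n) *ₛ pochhammer 1 n))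
      ≈⟨ R.+-cong (R.sym (shanksTerm-zero n))
                  (R.+-cong R.refl (R.-‿cong (R.*-cong R.refl (R.*-cong (^-congʳ x (exp n)) R.refl)))) ⟩
    shanksTerm n 0 +ₛ (shanksCorrection n 0 -ₛ shanksCorrection n 1) ∎
    where
    exp : ∀ m → suc m ≡ m ℕ.* 1 ℕ.+ 1
    exp = solve-∀

  shanksTerm-suc : ∀ j r → let n = suc j ℕ.+ r in
    shanksTerm (suc n) (suc j) ≈ shanksTerm n (suc j) +ₛ (shanksCorrection n (suc j) -ₛ shanksCorrection n (suc (suc j)))
  shanksTerm-suc j r = begin
    shanksTerm (suc n) (suc j)
      ≈⟨ R.*-cong R.refl (R.*-cong (R.trans (^-congʳ x (exp-term n j (triangle (suc j)))) (^-homo-* x E (suc j)))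
                                   (pochhammer-cong (suc (suc j)) (n∸j≡ j r))) ⟩
    (-ₛ s) *ₛ ((Y *ₛ a) *ₛ (Q *ₛ (1ₛ -ₛ b)))
      ≈⟨ solve 5 (λ s Y a b Q → (:- s) :* ((Y :* a) :* (Q :* (con (+ 1) :- b))) :=
            (:- s) :* (Y :* Q) :+ (s :* (Y :* ((con (+ 1) :- a) :* Q)) :- (:- s) :* ((Y :* (b :* a)) :* Q)))
          R.refl s Y a b Q ⟩
    (-ₛ s) *ₛ (Y *ₛ Q) +ₛ (s *ₛ (Y *ₛ ((1ₛ -ₛ a) *ₛ Q)) -ₛ (-ₛ s) *ₛ ((Y *ₛ (b *ₛ a)) *ₛ Q))
      ≈⟨ R.sym (R.+-cong term≈ (R.+-cong correction≈ (R.-‿cong next-correction≈))) ⟩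
    shanksTerm n (suc j) +ₛ (shanksCorrection n (suc j) -ₛ shanksCorrection n (suc (suc j))) ∎
    where
    n = suc j ℕ.+ r
    s = sign j
    E = n ℕ.* suc j ℕ.+ triangle (suc j)
    Y = x ^ E
    a = x ^ suc j
    b = x ^ suc n
    Q = pochhammer (suc (suc j)) r
    exp-term : ∀ n j t → suc n ℕ.* suc j ℕ.+ t ≡ (n ℕ.* suc j ℕ.+ t) ℕ.+ suc j
    exp-term = solve-∀
    exp-correction : ∀ n j t → n ℕ.* suc (suc j) ℕ.+ (suc (suc j) ℕ.+ t) ≡ (n ℕ.* suc j ℕ.+ t) ℕ.+ (suc n ℕ.+ suc j)
    exp-correction = solve-∀
    n∸j≡ : ∀ j r → (suc j ℕ.+ r) ∸ j ≡ suc r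
    n∸j≡ j r = trans (cong (_∸ j) (sym (ℕₚ.+-suc j r))) (ℕₚ.m+n∸m≡n j (suc r))
    term≈ : shanksTerm n (suc j) ≈ (-ₛ s) *ₛ (Y *ₛ Q)
    term≈ = R.*-cong R.refl (R.*-cong R.refl (pochhammer-cong (suc (suc j)) (ℕₚ.m+n∸m≡n j r)))
    correction≈ : shanksCorrection n (suc j) ≈ s *ₛ (Y *ₛ ((1ₛ -ₛ a) *ₛ Q))
    correction≈ = R.*-cong R.refl (R.*-cong R.refl (R.trans (pochhammer-cong (suc j) (n∸j≡ j r))
                                                            (pochhammer-front (suc j) r)))
    next-correction≈ : shanksCorrection n (suc (suc j)) ≈ (-ₛ s) *ₛ ((Y *ₛ (b *ₛ a)) *ₛ Q)
    next-correction≈ = R.*-cong R.refl (R.*-cong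
      (R.trans (^-congʳ x (exp-correction n j (triangle (suc j))))
               (R.trans (^-homo-* x E (suc n ℕ.+ suc j)) (R.*-cong R.refl (^-homo-* x (suc n) (suc j)))))
      (pochhammer-cong (suc (suc j)) (ℕₚ.m+n∸m≡n j r)))

  shanksTerm-step : ∀ n k → k < suc n →
    shanksTerm (suc n) k ≈ shanksTerm n k +ₛ (shanksCorrection n k -ₛ shanksCorrection n (suc k))
  shanksTerm-step n zero    _         = shanksTerm-suc₀ n
  shanksTerm-step n (suc j) (s≤s j<n) with ℕₚ.m≤n⇒∃[o]m+o≡n j<n
  ... | r , refl = shanksTerm-suc j r

  shanksSum : ℕ → Series
  shanksSum n = ∑< (suc n) (shanksTerm n)

  shanksCorrection-last : ∀ n → shanksCorrection n (suc n) ≈ sign n *ₛ x ^ pentagonal⁻ (suc n)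
  shanksCorrection-last n = R.*-cong R.refl (R.trans (R.*-cong R.refl (pochhammer-cong (suc n) (ℕₚ.n∸n≡0 n)))
                                                     (R.*-identityʳ _))

  shanksTerm-last : ∀ n → shanksTerm (suc n) (suc n) ≈ -ₛ sign n *ₛ x ^ pentagonal⁺ (suc n)
  shanksTerm-last n = R.*-cong R.refl (R.trans (R.*-cong R.refl (pochhammer-cong (suc (suc n)) (ℕₚ.n∸n≡0 n)))
                                               (R.*-identityʳ _))

  shanksSum-step : ∀ n → shanksSum (suc n) ≈
    shanksSum n +ₛ sign (suc n) *ₛ ((x ^ pentagonal⁻ (suc n)) +ₛ (x ^ pentagonal⁺ (suc n)))
  shanksSum-step n = begin
    ∑< (suc n) (shanksTerm (suc n)) +ₛ shanksTerm (suc n) (suc n)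
      ≈⟨ R.+-cong (∑<-cong (suc n) (shanksTerm-step n)) R.refl ⟩
    ∑< (suc n) (λ k → shanksTerm n k +ₛ (w k -ₛ w (suc k))) +ₛ shanksTerm (suc n) (suc n)
      ≈⟨ R.+-cong (R.trans (∑<-distrib-+ (suc n) (shanksTerm n) _) (R.+-cong R.refl (∑<-telescope (suc n) w))) R.refl ⟩
    (shanksSum n +ₛ (0ₛ -ₛ w (suc n))) +ₛ shanksTerm (suc n) (suc n)
      ≈⟨ R.+-cong (R.+-cong R.refl (R.+-cong R.refl (R.-‿cong (shanksCorrection-last n)))) (shanksTerm-last n) ⟩
    (shanksSum n +ₛ (0ₛ -ₛ sign n *ₛ A)) +ₛ -ₛ sign n *ₛ B
      ≈⟨ solve 4 (λ r s A B → (r :+ (con (+ 0) :- s :* A)) :+ (:- s) :* B := r :+ (:- s) :* (A :+ B))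
                 R.refl (shanksSum n) (sign n) A B ⟩
    shanksSum n +ₛ sign (suc n) *ₛ (A +ₛ B) ∎
    where
    w = shanksCorrection n
    A = x ^ pentagonal⁻ (suc n)
    B = x ^ pentagonal⁺ (suc n)

  shanks : ∀ n → shanksSum n ≈ pentagonalSum n
  shanks zero    = solve 0 (con (+ 0) :+ con (+ 1) :* (con (+ 1) :* con (+ 1)) := con (+ 1)) R.refl
  shanks (suc n) = R.trans (shanksSum-step n) (R.+-cong (shanks n) R.refl)

  shanksQuotientTerm : ℕ → ℕ → Series
  shanksQuotientTerm n k = sign (suc k) *ₛ ((x ^ (n ℕ.* k ℕ.+ triangle k ℕ.+ k)) *ₛ pochhammer (suc (suc k)) (n ∸ suc k))

  shanksTerm-divisible : ∀ n k → shanksTerm n (suc k) ≈ (x ^ suc n) *ₛ shanksQuotientTerm n k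
  shanksTerm-divisible n k = R.trans
    (R.*-cong R.refl (R.*-cong (R.trans (^-congʳ x (exp n k (triangle k))) (^-homo-* x (suc n) _)) R.refl))
    (solve 4 (λ s a b p → s :* ((a :* b) :* p) := a :* (s :* (b :* p))) R.refl (sign (suc k)) (x ^ suc n) _ _)
    where
    exp : ∀ n k t → n ℕ.* suc k ℕ.+ (suc k ℕ.+ t) ≡ suc n ℕ.+ (n ℕ.* k ℕ.+ t ℕ.+ k)
    exp = solve-∀

  pochhammer≈pentagonalSum : ∀ n → pochhammer 1 n ≈ pentagonalSum n mod⟨ x ^ suc n ⟩
  pochhammer≈pentagonalSum n = -ₛ H , (begin
    pochhammer 1 n
      ≈⟨ solve 3 (λ p y h → p := (p :+ y :* h) :- y :* h) R.refl (pochhammer 1 n) (x ^ suc n) H ⟩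
    (pochhammer 1 n +ₛ (x ^ suc n) *ₛ H) -ₛ (x ^ suc n) *ₛ H
      ≈⟨ R.+-cong (R.sym split) R.refl ⟩
    shanksSum n -ₛ (x ^ suc n) *ₛ H
      ≈⟨ R.+-cong (shanks n) (solve 2 (λ y h → :- (y :* h) := y :* (:- h)) R.refl (x ^ suc n) H) ⟩
    pentagonalSum n +ₛ (x ^ suc n) *ₛ (-ₛ H) ∎)
    where
    H = ∑< n (shanksQuotientTerm n)
    split : shanksSum n ≈ pochhammer 1 n +ₛ (x ^ suc n) *ₛ H
    split = R.trans (∑<-front n (shanksTerm n))
      (R.+-cong (shanksTerm-zero n)
                (R.trans (∑<-cong n (λ k _ → shanksTerm-divisible n k))
                         (∑<-distribˡ n (x ^ suc n) (shanksQuotientTerm n))))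

module FinitePentagonalQ (d : ℤ) (c : ℕ) where

  open SeriesMod d
  private module R = CommutativeRing ring
  open import Algebra.Properties.Semiring.Exp R.semiring using (_^_; ^-assocʳ; ^-congʳ; ^-homo-*)
  open FinitePentagonal d (q ^ c) public
  open ACR._-Raw-AlmostCommutative⟶_ cst-morphism using () renaming (-‿homo to cst-neg)

  sign≈cst : ∀ k → sign k ≈ cst (sgn (+ k))

  sign-suc≈ : ∀ k → sign (suc k) ≈ cst (sgn -[1+ k ])
  sign-suc≈ k = R.trans (R.-‿cong (sign≈cst k)) (R.sym (cst-neg (sgn (+ k))))

  sign≈cst zero    = R.refl
  sign≈cst (suc k) = R.trans (sign-suc≈ k) (R.reflexive (cong cst (sym (sgn-suc k))))

  signed-power : ∀ a e → cst a *ₛ (q ^ c) ^ e ≈ mono a (c ℕ.* e)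
  signed-power a e = begin
    cst a *ₛ (q ^ c) ^ e            ≈⟨ R.*-cong (cst≈mono a) (R.trans (^-assocʳ q c e) (q^≈mono (c ℕ.* e))) ⟩
    mono a 0 *ₛ mono (+ 1) (c ℕ.* e) ≈⟨ ≗⇒≈ (λ k → trans (*ₛ-coeff _ _ k) (mono-⊛-mono a 0 (+ 1) (c ℕ.* e) k)) ⟩
    mono (a * + 1) (c ℕ.* e)        ≈⟨ R.reflexive (cong (λ b → mono b (c ℕ.* e)) (ℤₚ.*-identityʳ a)) ⟩
    mono a (c ℕ.* e)                ∎
    where open import Relation.Binary.Reasoning.Setoid R.setoid

  pentagonalSum≈∑ : ∀ n → pentagonalSum n ≈ ∑[ j ∈ symmetricRange n ] mono (sgn j) (c ℕ.* pentagonal j)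
  pentagonalSum≈∑ zero    = R.trans (solve 0 (con (+ 1) := con (+ 1) :* con (+ 1) :+ con (+ 0)) R.refl)
                                    (R.+-cong (signed-power (+ 1) 0) R.refl)
  pentagonalSum≈∑ (suc n) = begin
    pentagonalSum n +ₛ sign (suc n) *ₛ (A +ₛ B)
      ≈⟨ solve 4 (λ p s a b → p :+ s :* (a :+ b) := s :* a :+ (s :* b :+ p))
                 R.refl (pentagonalSum n) (sign (suc n)) A B ⟩
    sign (suc n) *ₛ A +ₛ (sign (suc n) *ₛ B +ₛ pentagonalSum n)
      ≈⟨ R.+-cong (R.trans (R.*-cong (sign≈cst (suc n)) R.refl) (signed-power _ _))
                  (R.+-cong (R.trans (R.*-cong (sign-suc≈ n) R.refl) (signed-power _ _)) (pentagonalSum≈∑ n)) ⟩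
    ∑[ j ∈ symmetricRange (suc n) ] mono (sgn j) (c ℕ.* pentagonal j) ∎
    where
    open import Relation.Binary.Reasoning.Setoid R.setoid
    A = (q ^ c) ^ pentagonal⁻ (suc n)
    B = (q ^ c) ^ pentagonal⁺ (suc n)

  pochhammer≈pentagonalSum-mod-q^ : .{{NonZero c}} → ∀ n → pochhammer 1 n ≈ pentagonalSum n mod⟨ q ^ suc n ⟩
  pochhammer≈pentagonalSum-mod-q^ n = mod⟨⟩-divisor (q ^ (pred c ℕ.* suc n)) (begin
    (q ^ c) ^ suc n                        ≈⟨ ^-assocʳ q c (suc n) ⟩
    q ^ (c ℕ.* suc n)                      ≈⟨ ^-congʳ q (cong (ℕ._* suc n) (sym (ℕₚ.suc-pred c))) ⟩
    q ^ (suc n ℕ.+ pred c ℕ.* suc n)       ≈⟨ ^-homo-* q (suc n) (pred c ℕ.* suc n) ⟩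
    q ^ suc n *ₛ q ^ (pred c ℕ.* suc n)    ∎)
    (pochhammer≈pentagonalSum n)
    where open import Relation.Binary.Reasoning.Setoid R.setoid

-- Reduction modulo 11

open SeriesMod (+ 11)
private module R = CommutativeRing ring
open import Algebra.Properties.Semiring.Exp R.semiring using (_^_; ^-homo-*; ^-assocʳ; ^-congˡ; ^-congʳ)
open import Relation.Binary.Reasoning.Setoid R.setoid

-- Unlike the solver's own _:^_, this evaluates definitionally to the semiring power _^_.
_:^′_ : ∀ {k} → Polynomial k → ℕ → Polynomial k
p :^′ zero  = con (+ 1)
p :^′ suc e = p :* (p :^′ e)

-- The quotient by 11 has the coefficients (−1)ᵏ C(11, k)/11, 1 ≤ k ≤ 10.
frobenius : ∀ z → (1ₛ -ₛ z) ^ 11 ≈ 1ₛ -ₛ z ^ 11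
frobenius z = begin
  (1ₛ -ₛ z) ^ 11
    ≈⟨ solve 1 (λ z → (con (+ 1) :- z) :^′ 11 :=
         (con (+ 1) :- z :^′ 11) :+ con (+ 11) :* (
            con (- + 1) :* z :+ con (+ 5) :* z :^′ 2 :+ con (- + 15) :* z :^′ 3 :+ con (+ 30) :* z :^′ 4
            :+ con (- + 42) :* z :^′ 5 :+ con (+ 42) :* z :^′ 6 :+ con (- + 30) :* z :^′ 7
            :+ con (+ 15) :* z :^′ 8 :+ con (- + 5) :* z :^′ 9 :+ z :^′ 10)) R.refl z ⟩
  (1ₛ -ₛ z ^ 11) +ₛ cst (+ 11) *ₛ w ≈⟨ R.+-cong R.refl (R.trans (R.*-cong modulus≈0 R.refl) (R.zeroˡ w)) ⟩
  (1ₛ -ₛ z ^ 11) +ₛ 0ₛ              ≈⟨ R.+-identityʳ _ ⟩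
  1ₛ -ₛ z ^ 11                      ∎
  where
  w = cst (- + 1) *ₛ z +ₛ cst (+ 5) *ₛ z ^ 2 +ₛ cst (- + 15) *ₛ z ^ 3 +ₛ cst (+ 30) *ₛ z ^ 4
      +ₛ cst (- + 42) *ₛ z ^ 5 +ₛ cst (+ 42) *ₛ z ^ 6 +ₛ cst (- + 30) *ₛ z ^ 7
      +ₛ cst (+ 15) *ₛ z ^ 8 +ₛ cst (- + 5) *ₛ z ^ 9 +ₛ z ^ 10

one-minus-^24 : ∀ y → (1ₛ -ₛ y) ^ 24 ≈ (1ₛ -ₛ y) ^ 2 *ₛ (1ₛ -ₛ y ^ 11) ^ 2
one-minus-^24 y = begin
  (1ₛ -ₛ y) ^ (2 ℕ.+ 11 ℕ.* 2)       ≈⟨ ^-homo-* (1ₛ -ₛ y) 2 (11 ℕ.* 2) ⟩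
  (1ₛ -ₛ y) ^ 2 *ₛ (1ₛ -ₛ y) ^ (11 ℕ.* 2) ≈⟨ R.*-cong R.refl (R.sym (^-assocʳ (1ₛ -ₛ y) 11 2)) ⟩
  (1ₛ -ₛ y) ^ 2 *ₛ ((1ₛ -ₛ y) ^ 11) ^ 2 ≈⟨ R.*-cong R.refl (^-congˡ 2 (frobenius y)) ⟩
  (1ₛ -ₛ y) ^ 2 *ₛ (1ₛ -ₛ y ^ 11) ^ 2   ∎

module P₁  = FinitePentagonalQ (+ 11) 1
module P₁₁ = FinitePentagonalQ (+ 11) 11

partialEta24≈ : ∀ N → partialEta24 N ≈ P₁.pochhammer 1 N ^ 2 *ₛ P₁₁.pochhammer 1 N ^ 2
partialEta24≈ zero    = R.trans (powS≈^ q 0) (solve 0 (con (+ 1) := con (+ 1) :^′ 2 :* con (+ 1) :^′ 2) R.refl)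
partialEta24≈ (suc N) = begin
  powS (oneMinusQ (suc N)) 24 ⊛ partialEta24 N
    ≈⟨ R.trans (⊛≈*ₛ _ _) (R.*-cong (R.trans (powS≈^ _ 24) (^-congˡ 24 (oneMinusQ≈ N))) (partialEta24≈ N)) ⟩
  (1ₛ -ₛ q ^ suc N) ^ 24 *ₛ (P₁.pochhammer 1 N ^ 2 *ₛ P₁₁.pochhammer 1 N ^ 2)
    ≈⟨ R.*-cong (R.trans (one-minus-^24 (q ^ suc N)) (R.*-cong (^-congˡ 2 (R.+-cong R.refl (R.-‿cong y≈)))
                                                               (^-congˡ 2 (R.+-cong R.refl (R.-‿cong y¹¹≈))))) R.refl ⟩
  ((1ₛ -ₛ a) ^ 2 *ₛ (1ₛ -ₛ b) ^ 2) *ₛ (P₁.pochhammer 1 N ^ 2 *ₛ P₁₁.pochhammer 1 N ^ 2)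
    ≈⟨ solve 4 (λ a b P Q → ((con (+ 1) :- a) :^′ 2 :* (con (+ 1) :- b) :^′ 2) :* (P :^′ 2 :* Q :^′ 2) :=
                           (P :* (con (+ 1) :- a)) :^′ 2 :* (Q :* (con (+ 1) :- b)) :^′ 2)
               R.refl a b (P₁.pochhammer 1 N) (P₁₁.pochhammer 1 N) ⟩
  P₁.pochhammer 1 (suc N) ^ 2 *ₛ P₁₁.pochhammer 1 (suc N) ^ 2 ∎
  where
  a = (q ^ 1) ^ suc N
  b = (q ^ 11) ^ suc N
  y≈ : q ^ suc N ≈ a
  y≈ = R.sym (R.trans (^-assocʳ q 1 (suc N)) (^-congʳ q (ℕₚ.*-identityˡ (suc N))))
  y¹¹≈ : (q ^ suc N) ^ 11 ≈ b
  y¹¹≈ = R.trans (^-assocʳ q (suc N) 11) (R.trans (^-congʳ q (ℕₚ.*-comm (suc N) 11)) (R.sym (^-assocʳ q 11 (suc N))))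

S₁ S₁₁ : ℕ → Series
S₁  = P₁.pentagonalSum
S₁₁ = P₁₁.pentagonalSum

τ≡coeff : ∀ n → τ (suc n) ≡ (S₁ n ^ 2 *ₛ S₁₁ n ^ 2) n mod (+ 11)
τ≡coeff n = mod⟨q^⟩-coeff (mod⟨⟩-transˡ (partialEta24≈ n)
  (mod⟨⟩-*-cong (mod⟨⟩-^-cong (P₁.pochhammer≈pentagonalSum-mod-q^ n) 2)
                (mod⟨⟩-^-cong (P₁₁.pochhammer≈pentagonalSum-mod-q^ n) 2)))
  (ℕₚ.n<1+n n)

product≈∑ : ∀ n → S₁ n ^ 2 *ₛ S₁₁ n ^ 2 ≈ ∑[ t ∈ box n ] mono (sign₄ t) (exponent t)
product≈∑ n = begin
  S₁ n ^ 2 *ₛ S₁₁ n ^ 2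
    ≈⟨ solve 2 (λ a b → a :^′ 2 :* b :^′ 2 := a :* (a :* (b :* b))) R.refl (S₁ n) (S₁₁ n) ⟩
  S₁ n *ₛ (S₁ n *ₛ (S₁₁ n *ₛ S₁₁ n))
    ≈⟨ R.*-cong Σ₁ (R.*-cong Σ₁ (R.*-cong Σ₁₁ Σ₁₁)) ⟩
  ∑ js f₁ *ₛ (∑ js f₁ *ₛ (∑ js f₁₁ *ₛ ∑ js f₁₁))
    ≈⟨ R.trans (R.*-cong R.refl (R.*-cong R.refl (∑-*-∑ js js f₁₁ f₁₁)))
         (R.trans (R.*-cong R.refl (∑-*-∑ js _ f₁ _)) (∑-*-∑ js _ f₁ _)) ⟩
  ∑ (box n) _
    ≈⟨ ∑-cong (box n) collapse ⟩
  ∑[ t ∈ box n ] mono (sign₄ t) (exponent t) ∎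
  where
  js = symmetricRange n
  f₁ f₁₁ : ℤ → Series
  f₁  j = mono (sgn j) (1 ℕ.* pentagonal j)
  f₁₁ j = mono (sgn j) (11 ℕ.* pentagonal j)
  collapse : ∀ t → let (l , m , s , r) = t in f₁ l *ₛ (f₁ m *ₛ (f₁₁ s *ₛ f₁₁ r)) ≈ mono (sign₄ t) (exponent t)
  collapse (l , m , s , r) =
    R.trans (R.*-cong R.refl (R.*-cong R.refl (mono-*ₛ-mono (sgn s) (e₁₁ s) (sgn r) (e₁₁ r))))
      (R.trans (R.*-cong R.refl (mono-*ₛ-mono (sgn m) (e₁ m) (sgn s * sgn r) (e₁₁ s ℕ.+ e₁₁ r)))
        (mono-*ₛ-mono (sgn l) (e₁ l) (sgn m * (sgn s * sgn r)) (e₁ m ℕ.+ (e₁₁ s ℕ.+ e₁₁ r))))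
    where
    e₁ e₁₁ : ℤ → ℕ
    e₁  j = 1 ℕ.* pentagonal j
    e₁₁ j = 11 ℕ.* pentagonal j
  Σ₁  = P₁.pentagonalSum≈∑ n
  Σ₁₁ = P₁₁.pentagonalSum≈∑ n

τ≡weightSum : ∀ n → τ (suc n) ≡ weightSum (representations n) mod (+ 11)
τ≡weightSum n = ≡-mod-trans (τ≡coeff n) (≡-mod-trans (coeff (product≈∑ n) n)
  (≡⇒≡-mod (trans (∑-coeff (box n) _ n) (coefficient-∑ n (box n)))))


-- The congruence holds for n = 0 as well.
mainTheorem12 : (n : ℕ) → .{{_ : NonZero n}} →
    Σ (List Quad) (IsEnumeration n)
    × ((L : List Quad) → IsEnumeration n L →
    (+ 11) ∣ (τ (suc n) - weightSum L))
mainTheorem12 n = (representations n , representations-enumerate n) , λ L L-enumerates →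
  ℤ∣.∣⇒∣ᵤ (∣-difference (subst (λ w → τ (suc n) ≡ w mod (+ 11))
    (enumerations-weightSum (representations-enumerate n) L-enumerates) (τ≡weightSum n)))
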